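{- For every non-negative integer $m$ and every $1\le c_1<\dots<c_m\le 2m$, \[ \sum_{\sigma}q^{v(\sigma)}=\prod_{j=1}^m[r_j-(j-1)]_q, \] where the sum is over all fixed-point-free involutions $\sigma$ of $\{1,\dots,2m\}$ whose set of opening nodes is $\{c_1,\dots,c_m\}$, and $r_j=\#\{i\in\{1,\dots,m\}: c_i\le j+i-1\}$.
   Context: For a fixed-point-free involution $\sigma$ of $\{1,\dots,2m\}$, its arcs are the pairs $(i,\sigma(i))$ with $i<\sigma(i)$; $i$ is an opening node and $\sigma(i)$ a closing node. A crossing is a pair of arcs $(i,j),(k,l)$ with $i<k<j<l$, and $v(\sigma)$ is the number of crossings. For a non-negative integer $n$, $[n]_q=1+q+\dots+q^{n-1}$. -}

module Defs where

open import Level using (Level)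
open import Data.Nat as ℕ using (ℕ; zero; suc; _∸_)
open import Data.Fin as Fin using (Fin; toℕ; _<_)
open import Data.Fin.Properties using (_<?_; _≟_; all?; any?)
open import Data.List using (List; []; _∷_; map; concatMap; length; filter; cartesianProduct; allFin; foldr; tabulate)
open import Data.Product using (_×_; _,_; ∃; proj₁; proj₂)
open import Relation.Binary.PropositionalEquality using (_≡_; _≢_)
open import Relation.Nullary using (Dec; ¬_)
open import Relation.Nullary.Decidable using (_×-dec_; _→-dec_; ¬?)
open import Algebra.Bundles using (CommutativeSemiring)
import Algebra.Definitions.RawSemiring as RS

-- Nodes {1,…,n} are represented by Fin n (node t ↔ toℕ t + 1).

IsFPFInvolution : ∀ {n} → (Fin n → Fin n) → Set
IsFPFInvolution {n} σ = ∀ i → (σ (σ i) ≡ i) × (σ i ≢ i)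

Opening : ∀ {n} → (Fin n → Fin n) → Fin n → Set
Opening σ i = i < σ i

OpeningSetIs : ∀ {n m} → (Fin n → Fin n) → (Fin m → Fin n) → Set
OpeningSetIs {n} σ c = ∀ i → (Opening σ i → ∃ λ j → c j ≡ i) × ((∃ λ j → c j ≡ i) → Opening σ i)

StrictlyIncreasing : ∀ {n m} → (Fin m → Fin n) → Set
StrictlyIncreasing c = ∀ i j → i < j → c i < c j

-- All functions Fin n → Fin k (each extensionally distinct function once).
allFuns : ∀ n k → List (Fin n → Fin k)
allFuns zero    k = (λ ()) ∷ []
allFuns (suc n) k = concatMap (λ a → map (λ f → cons a f) (allFuns n k)) (allFin k)
  where
  cons : Fin k → (Fin n → Fin k) → Fin (suc n) → Fin k
  cons a f Fin.zero    = a
  cons a f (Fin.suc i) = f i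

isFPFInvolution? : ∀ {n} (σ : Fin n → Fin n) → Dec (IsFPFInvolution σ)
isFPFInvolution? σ = all? (λ i → (σ (σ i) ≟ i) ×-dec ¬? (σ i ≟ i))

openingSetIs? : ∀ {n m} (σ : Fin n → Fin n) (c : Fin m → Fin n) → Dec (OpeningSetIs σ c)
openingSetIs? σ c = all? (λ i → ((i <? σ i) →-dec any? (λ j → c j ≟ i))
                                ×-dec (any? (λ j → c j ≟ i) →-dec (i <? σ i)))

Crossing : ∀ {n} → (Fin n → Fin n) → Fin n × Fin n → Set
Crossing σ (i , k) = (i < k) × ((k < σ i) × (σ i < σ k))

crossing? : ∀ {n} (σ : Fin n → Fin n) (p : Fin n × Fin n) → Dec (Crossing σ p)
crossing? σ (i , k) = (i <? k) ×-dec ((k <? σ i) ×-dec (σ i <? σ k))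

v : ∀ {n} → (Fin n → Fin n) → ℕ
v {n} σ = length (filter (crossing? σ) (cartesianProduct (allFin n) (allFin n)))

matchings : ∀ n {m} → (Fin m → Fin n) → List (Fin n → Fin n)
matchings n c = filter (λ σ → isFPFInvolution? σ ×-dec openingSetIs? σ c) (allFuns n n)

-- r_j (0-indexed: j' = j-1, i' = i-1):
--   r_j = #{ i ∈ {1..m} : c_i ≤ j + i - 1 }  becomes  #{ i' : toℕ(c i') ≤ j' + i' }.
r : ∀ {n m} → (Fin m → Fin n) → Fin m → ℕ
r {m = m} c j = length (filter (λ i → toℕ (c i) ℕ.≤? toℕ j ℕ.+ toℕ i) (allFin m))

module _ {a ℓ : Level} (R : CommutativeSemiring a ℓ) where
  open CommutativeSemiring R
  open RS rawSemiring using (_^_)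

  Σ-list : List Carrier → Carrier
  Σ-list = foldr _+_ 0#

  Π-list : List Carrier → Carrier
  Π-list = foldr _*_ 1#

  qInt : Carrier → ℕ → Carrier
  qInt q n = Σ-list (tabulate {n = n} (λ k → q ^ toℕ k))

  crossingGF : Carrier → (m : ℕ) → (Fin m → Fin (2 ℕ.* m)) → Carrier
  crossingGF q m c = Σ-list (map (λ σ → q ^ v σ) (matchings (2 ℕ.* m) c))

  productFormula : Carrier → (m : ℕ) → (Fin m → Fin (2 ℕ.* m)) → Carrier
  productFormula q m c = Π-list (tabulate (λ j → qInt q (r c j ∸ toℕ j)))

{-# OPTIONS --safe #-}
-- Let d be the first node that is not an opening node, so that the nodes before it all open and
-- r_1 = d. In every matching node d closes an arc (o, d) with o < d, and every opener strictly
-- between o and d is closed beyond d, so this arc crosses exactly t = d − 1 − o arcs. Deleting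
-- the arc leaves a matching of 2m − 2 nodes whose opening set c⁻ has r_j(c⁻) = r_{j+1}(c) − 1,
-- and every such matching arises from exactly one choice of t. Hence the generating function is
-- [d]_q times the one for c⁻, and induction on m gives the product. As the matchings are
-- enumerated as a list of functions, this bijection becomes an equality of sums by comparing
-- multiplicities up to pointwise equality.
module Submission where

open import Defs
open import Level using (Level; 0ℓ)
open import Data.Nat as ℕ using (ℕ; zero; suc; _+_; _∸_; z≤n; s≤s)
import Data.Nat.Properties as ℕₚ
open import Algebra.Properties.CommutativeSemigroup ℕₚ.+-commutativeSemigroup
  using () renaming (x∙yz≈y∙xz to +-x∙yz≈y∙xz)
open import Algebra.Properties.CommutativeMonoid.Sum ℕₚ.+-0-commutativeMonoid
  using (sum; sum-syntax; sum-remove; sum-cong-≗; sum-replicate-zero)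
open import Data.Fin as Fin using (Fin; toℕ; fromℕ<; punchIn; punchOut)
import Data.Fin.Properties as Finₚ
open import Data.List
  using (List; []; _∷_; _++_; map; concatMap; filter; length; tabulate; allFin; cartesianProduct; foldr)
import Data.List.Properties as Listₚ
open import Data.List.Relation.Unary.All as All using (All; []; _∷_)
open import Data.List.Relation.Unary.All.Properties using (all-filter)
import Data.List.Relation.Binary.Permutation.Setoid.Properties
open import Data.Product using (_×_; _,_; proj₁; proj₂; ∃; Σ-syntax)
open import Data.Empty using (⊥-elim)
open import Function using (_∘_; id; _⇔_; mk⇔; Equivalence)
open import Relation.Nullary using (Dec; yes; no; ¬_)
open import Relation.Nullary.Decidable using (_×-dec_)
open import Relation.Unary using (Pred; Decidable)
open import Relation.Binary using (DecSetoid; Setoid; tri<; tri≈; tri>)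
open import Relation.Binary.PropositionalEquality
  using (_≡_; _≢_; refl; sym; trans; cong; cong₂; subst; subst₂; _≗_; _→-setoid_; module ≡-Reasoning)
open import Algebra.Bundles using (CommutativeMonoid; CommutativeSemiring)

private
  variable
    a ℓ₁ ℓ₂ : Level
    A B : Set a

𝟙 : {P : Set ℓ₁} → Dec P → ℕ
𝟙 (yes _) = 1
𝟙 (no _)  = 0

𝟙-yes : {P : Set ℓ₁} (P? : Dec P) → P → 𝟙 P? ≡ 1
𝟙-yes (yes _) _ = refl
𝟙-yes (no ¬P) P = ⊥-elim (¬P P)

𝟙-no : {P : Set ℓ₁} (P? : Dec P) → ¬ P → 𝟙 P? ≡ 0
𝟙-no (yes P) ¬P = ⊥-elim (¬P P)
𝟙-no (no _)  _  = refl

𝟙-cong : {P : Set ℓ₁} {Q : Set ℓ₂} (P? : Dec P) (Q? : Dec Q) → P ⇔ Q → 𝟙 P? ≡ 𝟙 Q?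
𝟙-cong (yes P) Q? P⇔Q = sym (𝟙-yes Q? (Equivalence.to P⇔Q P))
𝟙-cong (no ¬P) Q? P⇔Q = sym (𝟙-no Q? (¬P ∘ Equivalence.from P⇔Q))

count : {P : Pred A ℓ₁} → Decidable P → List A → ℕ
count P? xs = length (filter P? xs)

count-∷ : {P : Pred A ℓ₁} (P? : Decidable P) → ∀ x xs → count P? (x ∷ xs) ≡ 𝟙 (P? x) + count P? xs
count-∷ P? x xs with P? x
... | yes _ = refl
... | no _  = refl

count-++ : {P : Pred A ℓ₁} (P? : Decidable P) → ∀ xs ys → count P? (xs ++ ys) ≡ count P? xs + count P? ys
count-++ P? xs ys = trans (cong length (Listₚ.filter-++ P? xs ys)) (Listₚ.length-++ (filter P? xs))

count-none : {P : Pred A ℓ₁} (P? : Decidable P) → (∀ x → ¬ P x) → ∀ xs → count P? xs ≡ 0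
count-none P? ¬P []       = refl
count-none P? ¬P (x ∷ xs) = trans (count-∷ P? x xs) (cong₂ _+_ (𝟙-no (P? x) (¬P x)) (count-none P? ¬P xs))

count-cong : {P : Pred A ℓ₁} {Q : Pred A ℓ₂} (P? : Decidable P) (Q? : Decidable Q) →
             (∀ x → P x ⇔ Q x) → ∀ xs → count P? xs ≡ count Q? xs
count-cong P? Q? P⇔Q []       = refl
count-cong P? Q? P⇔Q (x ∷ xs) = begin
  count P? (x ∷ xs)       ≡⟨ count-∷ P? x xs ⟩
  𝟙 (P? x) + count P? xs  ≡⟨ cong₂ _+_ (𝟙-cong (P? x) (Q? x) (P⇔Q x)) (count-cong P? Q? P⇔Q xs) ⟩
  𝟙 (Q? x) + count Q? xs  ≡⟨ count-∷ Q? x xs ⟨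
  count Q? (x ∷ xs)       ∎
  where open ≡-Reasoning

count-map : {P : Pred A ℓ₁} (P? : Decidable P) (f : B → A) → ∀ xs → count P? (map f xs) ≡ count (P? ∘ f) xs
count-map P? f []       = refl
count-map P? f (x ∷ xs) = begin
  count P? (map f (x ∷ xs))          ≡⟨ count-∷ P? (f x) (map f xs) ⟩
  𝟙 (P? (f x)) + count P? (map f xs) ≡⟨ cong (𝟙 (P? (f x)) +_) (count-map P? f xs) ⟩
  𝟙 (P? (f x)) + count (P? ∘ f) xs   ≡⟨ count-∷ (P? ∘ f) x xs ⟨
  count (P? ∘ f) (x ∷ xs)            ∎
  where open ≡-Reasoning

count-filter : {P : Pred A ℓ₁} {Q : Pred A ℓ₂} (P? : Decidable P) (Q? : Decidable Q) →
               ∀ xs → count P? (filter Q? xs) ≡ count (λ x → P? x ×-dec Q? x) xs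
count-filter P? Q? []       = refl
count-filter {Q = Q} P? Q? (x ∷ xs) = begin
  count P? (filter Q? (x ∷ xs))       ≡⟨ step (Q? x) ⟩
  𝟙 (P? x ×-dec Q? x) + count PQ? xs  ≡⟨ count-∷ PQ? x xs ⟨
  count PQ? (x ∷ xs)                  ∎
  where
  open ≡-Reasoning
  PQ? = λ x → P? x ×-dec Q? x
  step : (Qx? : Dec (Q x)) → count P? (filter Q? (x ∷ xs)) ≡ 𝟙 (P? x ×-dec Qx?) + count PQ? xs
  step (yes Qx) = begin
    count P? (filter Q? (x ∷ xs))         ≡⟨ cong (count P?) (Listₚ.filter-accept Q? Qx) ⟩
    count P? (x ∷ filter Q? xs)           ≡⟨ count-∷ P? x _ ⟩
    𝟙 (P? x) + count P? (filter Q? xs)    ≡⟨ cong₂ _+_ (𝟙-cong (P? x) (P? x ×-dec yes Qx) (mk⇔ (_, Qx) proj₁))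
                                                       (count-filter P? Q? xs) ⟩
    𝟙 (P? x ×-dec yes Qx) + count PQ? xs  ∎
  step (no ¬Qx) = begin
    count P? (filter Q? (x ∷ xs))         ≡⟨ cong (count P?) (Listₚ.filter-reject Q? ¬Qx) ⟩
    count P? (filter Q? xs)               ≡⟨ count-filter P? Q? xs ⟩
    count PQ? xs                          ≡⟨ cong (_+ count PQ? xs) (𝟙-no (P? x ×-dec no ¬Qx) (¬Qx ∘ proj₂)) ⟨
    𝟙 (P? x ×-dec no ¬Qx) + count PQ? xs  ∎

count-tabulate : {P : Pred A ℓ₁} (P? : Decidable P) → ∀ {n} (f : Fin n → A) →
                 count P? (tabulate f) ≡ ∑[ i < n ] 𝟙 (P? (f i))
count-tabulate P? {zero}  f = refl
count-tabulate P? {suc n} f =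
  trans (count-∷ P? (f Fin.zero) _) (cong (𝟙 (P? (f Fin.zero)) +_) (count-tabulate P? (f ∘ Fin.suc)))

count-concatMap : {P : Pred A ℓ₁} (P? : Decidable P) → ∀ {n} (F : Fin n → List A) →
                  count P? (concatMap F (allFin n)) ≡ ∑[ i < n ] count P? (F i)
count-concatMap P? F = go F id
  where
  go : ∀ {n k} (F : Fin k → List _) (f : Fin n → Fin k) →
       count P? (concatMap F (tabulate f)) ≡ ∑[ i < n ] count P? (F (f i))
  go {zero}  F f = refl
  go {suc n} F f =
    trans (count-++ P? (F (f Fin.zero)) _) (cong (count P? (F (f Fin.zero)) +_) (go F (f ∘ Fin.suc)))

count-cartesianProduct : ∀ {m n} {P : Pred (Fin m × Fin n) ℓ₁} (P? : Decidable P) →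
  count P? (cartesianProduct (allFin m) (allFin n)) ≡ ∑[ i < m ] ∑[ k < n ] 𝟙 (P? (i , k))
count-cartesianProduct {m = m} {n} P? = go id
  where
  go : ∀ {l} (f : Fin l → Fin m) →
       count P? (cartesianProduct (tabulate f) (allFin n)) ≡ ∑[ i < l ] ∑[ k < n ] 𝟙 (P? (f i , k))
  go {zero}  f = refl
  go {suc l} f = begin
    count P? (row ++ _)                          ≡⟨ count-++ P? row _ ⟩
    count P? row + _                             ≡⟨ cong₂ _+_ (trans (count-map P? (f Fin.zero ,_) (allFin n))
                                                                    (count-tabulate (P? ∘ (f Fin.zero ,_)) id))
                                                              (go (f ∘ Fin.suc)) ⟩
    ∑[ i < suc l ] ∑[ k < n ] 𝟙 (P? (f i , k))  ∎
    where
    open ≡-Reasoning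
    row = map (f Fin.zero ,_) (allFin n)

∑-single-support : ∀ {n} (f : Fin n → ℕ) (i : Fin n) → (∀ j → j ≢ i → f j ≡ 0) → ∑[ j < n ] f j ≡ f i
∑-single-support {suc n} f i f≡0 = begin
  sum f                      ≡⟨ sum-remove f ⟩
  f i + sum (f ∘ punchIn i)  ≡⟨ cong (f i +_) (sum-cong-≗ (λ j → f≡0 (punchIn i j) (Finₚ.punchInᵢ≢i i j))) ⟩
  f i + sum {n} (λ _ → 0)    ≡⟨ cong (f i +_) (sum-replicate-zero n) ⟩
  f i + 0                    ≡⟨ ℕₚ.+-identityʳ (f i) ⟩
  f i                        ∎
  where open ≡-Reasoning

∑-below : ∀ N b → b ℕ.≤ N → ∑[ k < N ] 𝟙 (toℕ k ℕ.<? b) ≡ b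
∑-below N       zero    _ = trans (sum-cong-≗ {N} (λ k → 𝟙-no (toℕ k ℕ.<? 0) λ ())) (sum-replicate-zero N)
∑-below (suc N) (suc b) (s≤s b≤N) = cong suc (trans
  (sum-cong-≗ {N} (λ k → 𝟙-cong (suc (toℕ k) ℕ.<? suc b) (toℕ k ℕ.<? b) (mk⇔ ℕ.s≤s⁻¹ s≤s)))
  (∑-below N b b≤N))

∑-between : ∀ N a b → b ℕ.≤ N → ∑[ k < N ] 𝟙 ((a ℕ.<? toℕ k) ×-dec (toℕ k ℕ.<? b)) ≡ b ∸ suc a
∑-between N a zero _ =
  trans (sum-cong-≗ {N} (λ k → 𝟙-no ((a ℕ.<? toℕ k) ×-dec (toℕ k ℕ.<? 0)) (λ ()))) (sum-replicate-zero N)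
∑-between (suc N) zero (suc b) (s≤s b≤N) = trans
  (sum-cong-≗ {N} (λ k → 𝟙-cong ((0 ℕ.<? suc (toℕ k)) ×-dec (suc (toℕ k) ℕ.<? suc b)) (toℕ k ℕ.<? b)
                                (mk⇔ (ℕ.s≤s⁻¹ ∘ proj₂) (λ k<b → s≤s z≤n , s≤s k<b))))
  (∑-below N b b≤N)
∑-between (suc N) (suc a) (suc b) (s≤s b≤N) = trans
  (sum-cong-≗ {N} (λ k → 𝟙-cong ((suc a ℕ.<? suc (toℕ k)) ×-dec (suc (toℕ k) ℕ.<? suc b))
                                ((a ℕ.<? toℕ k) ×-dec (toℕ k ℕ.<? b))
                                (mk⇔ (λ (p , q) → ℕ.s≤s⁻¹ p , ℕ.s≤s⁻¹ q) (λ (p , q) → s≤s p , s≤s q))))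
  (∑-between N a b b≤N)

-- Sums over lists with equal multiplicities

module Multiplicity {c ℓ} (S : DecSetoid c ℓ) where

  open DecSetoid S using (Carrier; _≈_; _≟_; setoid)
  private module S = DecSetoid S
  open import Data.List.Relation.Binary.Permutation.Setoid setoid
    using (_↭_; ↭-refl; ↭-prep; ↭-trans; ↭-sym)
  open import Data.List.Relation.Binary.Permutation.Setoid.Properties setoid using (shift; map⁺)

  multiplicity : Carrier → List Carrier → ℕ
  multiplicity x = count (_≟ x)

  multiplicity-head : ∀ x xs → 1 ℕ.≤ multiplicity x (x ∷ xs)
  multiplicity-head x xs = subst (1 ℕ.≤_) (sym (count-∷ (_≟ x) x xs))
    (subst (ℕ._≤ 𝟙 (x ≟ x) + multiplicity x xs) (𝟙-yes (x ≟ x) S.refl) (ℕₚ.m≤m+n _ _))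

  multiplicity-middle : ∀ z xs y ys →
                        multiplicity z (xs ++ y ∷ ys) ≡ 𝟙 (y ≟ z) + multiplicity z (xs ++ ys)
  multiplicity-middle z xs y ys = begin
    multiplicity z (xs ++ y ∷ ys)                        ≡⟨ count-++ (_≟ z) xs (y ∷ ys) ⟩
    multiplicity z xs + multiplicity z (y ∷ ys)          ≡⟨ cong (multiplicity z xs +_) (count-∷ (_≟ z) y ys) ⟩
    multiplicity z xs + (𝟙 (y ≟ z) + multiplicity z ys)  ≡⟨ +-x∙yz≈y∙xz (multiplicity z xs) (𝟙 (y ≟ z)) _ ⟩
    𝟙 (y ≟ z) + (multiplicity z xs + multiplicity z ys)  ≡⟨ cong (𝟙 (y ≟ z) +_) (count-++ (_≟ z) xs ys) ⟨
    𝟙 (y ≟ z) + multiplicity z (xs ++ ys)                ∎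
    where open ≡-Reasoning

  split-at-occurrence : ∀ x ys → 1 ℕ.≤ multiplicity x ys →
    Σ[ xs ∈ List Carrier ] Σ[ y ∈ Carrier ] Σ[ zs ∈ List Carrier ] ys ≡ xs ++ y ∷ zs × y ≈ x
  split-at-occurrence x (y ∷ ys) 1≤m with y ≟ x
  ... | yes y≈x = [] , y , ys , refl , y≈x
  ... | no _ with split-at-occurrence x ys 1≤m
  ...   | xs , y′ , zs , refl , y′≈x = y ∷ xs , y′ , zs , refl , y′≈x

  ↭-multiplicity : ∀ xs ys → (∀ z → multiplicity z xs ≡ multiplicity z ys) → xs ↭ ys
  ↭-multiplicity [] [] _ = ↭-refl
  ↭-multiplicity [] (y ∷ ys) eq with () ← subst (1 ℕ.≤_) (sym (eq y)) (multiplicity-head y ys)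
  ↭-multiplicity (x ∷ xs) ys eq
    with as , y , bs , refl , y≈x ← split-at-occurrence x ys (subst (1 ℕ.≤_) (eq x) (multiplicity-head x xs)) =
    ↭-trans (↭-prep x (↭-multiplicity xs (as ++ bs) eq′)) (↭-sym (shift y≈x as bs))
    where
    eq′ : ∀ z → multiplicity z xs ≡ multiplicity z (as ++ bs)
    eq′ z = ℕₚ.+-cancelˡ-≡ (𝟙 (y ≟ z)) _ _ (begin
      𝟙 (y ≟ z) + multiplicity z xs          ≡⟨ cong (_+ multiplicity z xs) (𝟙-cong (y ≟ z) (x ≟ z) y≈z⇔x≈z) ⟩
      𝟙 (x ≟ z) + multiplicity z xs          ≡⟨ count-∷ (_≟ z) x xs ⟨
      multiplicity z (x ∷ xs)                ≡⟨ eq z ⟩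
      multiplicity z (as ++ y ∷ bs)          ≡⟨ multiplicity-middle z as y bs ⟩
      𝟙 (y ≟ z) + multiplicity z (as ++ bs)  ∎)
      where
      open ≡-Reasoning
      y≈z⇔x≈z = mk⇔ (S.trans (S.sym y≈x)) (S.trans y≈x)

  module _ {m ℓm} (M : CommutativeMonoid m ℓm) where

    open CommutativeMonoid M using (_∙_; ε; isCommutativeMonoid)
      renaming (Carrier to V; _≈_ to _≈ᴹ_; setoid to Vₛ)
    private module Vₚ = Data.List.Relation.Binary.Permutation.Setoid.Properties Vₛ

    foldr-map-resp-multiplicity : {w : Carrier → V} → (∀ {x y} → x ≈ y → w x ≈ᴹ w y) →
      ∀ xs ys → (∀ z → multiplicity z xs ≡ multiplicity z ys) →
      foldr _∙_ ε (map w xs) ≈ᴹ foldr _∙_ ε (map w ys)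
    foldr-map-resp-multiplicity w-resp xs ys eq =
      Vₚ.foldr-commMonoid isCommutativeMonoid (map⁺ Vₛ w-resp (↭-multiplicity xs ys eq))

_≗?_ : ∀ {n k} (f g : Fin n → Fin k) → Dec (f ≗ g)
f ≗? g = Finₚ.all? (λ i → f i Finₚ.≟ g i)

≗-decSetoid : ℕ → ℕ → DecSetoid 0ℓ 0ℓ
≗-decSetoid n k = record
  { isDecEquivalence = record
    { isEquivalence = Setoid.isEquivalence (Fin n →-setoid Fin k)
    ; _≟_ = _≗?_ } }

count-allFuns : ∀ n k (g : Fin n → Fin k) → count (_≗? g) (allFuns n k) ≡ 1
count-allFuns zero    k g = 𝟙-yes ((λ ()) ≗? g) (λ ())
count-allFuns (suc n) k g = trans (count-concatMap (_≗? g) {k} _) (trans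
  (∑-single-support _ (g Fin.zero) (λ a → prefix-miss a _ (λ _ → refl) (λ _ _ → refl)))
  (prefix-hit _ _ (λ _ → refl) (λ _ _ → refl) refl))
  where
  module _ (a : Fin k) (ext : (Fin n → Fin k) → Fin (suc n) → Fin k)
           (ext-zero : ∀ f → ext f Fin.zero ≡ a) (ext-suc : ∀ f i → ext f (Fin.suc i) ≡ f i) where

    ext-≗ : ∀ f → ext f ≗ g ⇔ (a ≡ g Fin.zero × f ≗ g ∘ Fin.suc)
    ext-≗ f = mk⇔
      (λ e → trans (sym (ext-zero f)) (e Fin.zero) , λ i → trans (sym (ext-suc f i)) (e (Fin.suc i)))
      (λ { (a≡ , e) Fin.zero → trans (ext-zero f) a≡ ; (a≡ , e) (Fin.suc i) → trans (ext-suc f i) (e i) })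

    prefix-miss : a ≢ g Fin.zero → count (_≗? g) (map ext (allFuns n k)) ≡ 0
    prefix-miss a≢ = trans (count-map (_≗? g) ext (allFuns n k))
      (count-none (λ f → ext f ≗? g) (λ f e → a≢ (proj₁ (Equivalence.to (ext-≗ f) e))) (allFuns n k))

    prefix-hit : a ≡ g Fin.zero → count (_≗? g) (map ext (allFuns n k)) ≡ 1
    prefix-hit a≡ = begin
      count (_≗? g) (map ext (allFuns n k))    ≡⟨ count-map (_≗? g) ext (allFuns n k) ⟩
      count (λ f → ext f ≗? g) (allFuns n k)   ≡⟨ count-cong (λ f → ext f ≗? g) (_≗? (g ∘ Fin.suc)) equiv (allFuns n k) ⟩
      count (_≗? (g ∘ Fin.suc)) (allFuns n k)  ≡⟨ count-allFuns n k (g ∘ Fin.suc) ⟩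
      1                                        ∎
      where
      open ≡-Reasoning
      equiv : ∀ f → ext f ≗ g ⇔ f ≗ g ∘ Fin.suc
      equiv f = mk⇔ (proj₂ ∘ Equivalence.to (ext-≗ f)) (Equivalence.from (ext-≗ f) ∘ (a≡ ,_))

prefixLength : ∀ {m} {P : Pred (Fin m) ℓ₁} → Decidable P → ℕ
prefixLength {m = zero}  P? = 0
prefixLength {m = suc m} P? with P? Fin.zero
... | yes _ = suc (prefixLength (P? ∘ Fin.suc))
... | no _  = 0

prefixLength-≤ : ∀ {m} {P : Pred (Fin m) ℓ₁} (P? : Decidable P) → prefixLength P? ℕ.≤ m
prefixLength-≤ {m = zero}  P? = z≤n
prefixLength-≤ {m = suc m} P? with P? Fin.zero
... | yes _ = s≤s (prefixLength-≤ (P? ∘ Fin.suc))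
... | no _  = z≤n

prefixLength-holds : ∀ {m} {P : Pred (Fin m) ℓ₁} (P? : Decidable P) i → toℕ i ℕ.< prefixLength P? → P i
prefixLength-holds {m = suc m} P? i i<l with P? Fin.zero
prefixLength-holds {m = suc m} P? Fin.zero    _         | yes P0 = P0
prefixLength-holds {m = suc m} P? (Fin.suc i) (s≤s i<l) | yes _  = prefixLength-holds (P? ∘ Fin.suc) i i<l

prefixLength-fails : ∀ {m} {P : Pred (Fin m) ℓ₁} (P? : Decidable P) i → toℕ i ≡ prefixLength P? → ¬ P i
prefixLength-fails {m = suc m} P? i i≡l with P? Fin.zero
prefixLength-fails {m = suc m} P? (Fin.suc i) i≡l | yes _  =
  prefixLength-fails (P? ∘ Fin.suc) i (ℕₚ.suc-injective i≡l)
prefixLength-fails {m = suc m} P? Fin.zero    _   | no ¬P0 = ¬P0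

module _ {m n} {c : Fin m → Fin n} (c↑ : StrictlyIncreasing c) where

  increasing-gap : ∀ k (i j : Fin m) → toℕ j ≡ k + toℕ i → k + toℕ (c i) ℕ.≤ toℕ (c j)
  increasing-gap zero    i j           j≡i = ℕₚ.≤-reflexive (cong (toℕ ∘ c) (Finₚ.toℕ-injective (sym j≡i)))
  increasing-gap (suc k) i (Fin.suc j) j≡i = ℕₚ.<-≤-trans
    (s≤s (increasing-gap k i (Fin.inject₁ j) (trans (Finₚ.toℕ-inject₁ j) (ℕₚ.suc-injective j≡i))))
    (c↑ (Fin.inject₁ j) (Fin.suc j) (ℕₚ.≤-reflexive (cong suc (Finₚ.toℕ-inject₁ j))))

  increasing-≥ : ∀ i → toℕ i ℕ.≤ toℕ (c i)
  increasing-≥ Fin.zero       = z≤n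
  increasing-≥ i@(Fin.suc _) =
    ℕₚ.≤-trans (ℕₚ.m≤m+n _ _) (increasing-gap (toℕ i) Fin.zero i (sym (ℕₚ.+-identityʳ _)))

  increasing-injective : ∀ {i j} → c i ≡ c j → i ≡ j
  increasing-injective {i} {j} ci≡cj with ℕₚ.<-cmp (toℕ i) (toℕ j)
  ... | tri< i<j _ _ = ⊥-elim (ℕₚ.<-irrefl (cong toℕ ci≡cj) (c↑ i j i<j))
  ... | tri≈ _ i≡j _ = Finₚ.toℕ-injective i≡j
  ... | tri> _ _ j<i = ⊥-elim (ℕₚ.<-irrefl (cong toℕ (sym ci≡cj)) (c↑ j i j<i))

record FixedPrefix {m n} (c : Fin m → Fin n) : Set where
  field
    d     : ℕ
    d≤m   : d ℕ.≤ m
    fixed : ∀ i → toℕ i ℕ.< d → toℕ (c i) ≡ toℕ i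
    moved : ∀ i → d ℕ.≤ toℕ i → toℕ i ℕ.< toℕ (c i)

fixedPrefix : ∀ {m n} {c : Fin m → Fin n} → StrictlyIncreasing c → FixedPrefix c
fixedPrefix {c = c} c↑ = record
  { d     = d
  ; d≤m   = prefixLength-≤ fixed?
  ; fixed = prefixLength-holds fixed?
  ; moved = moved }
  where
  fixed? = λ i → toℕ (c i) ℕ.≟ toℕ i
  d = prefixLength fixed?

  moved : ∀ i → d ℕ.≤ toℕ i → toℕ i ℕ.< toℕ (c i)
  moved i d≤i = begin-strict
    toℕ i                      ≡⟨ i≡ ⟩
    toℕ i ∸ d + toℕ first      <⟨ ℕₚ.+-monoʳ-< (toℕ i ∸ d) first-moves ⟩
    toℕ i ∸ d + toℕ (c first)  ≤⟨ increasing-gap c↑ (toℕ i ∸ d) first i i≡ ⟩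
    toℕ (c i)                  ∎
    where
    open ℕₚ.≤-Reasoning
    d<m = ℕₚ.≤-<-trans d≤i (Finₚ.toℕ<n i)
    first = fromℕ< d<m
    first-moves : toℕ first ℕ.< toℕ (c first)
    first-moves = ℕₚ.≤∧≢⇒< (increasing-≥ c↑ first)
                           (prefixLength-fails fixed? first (Finₚ.toℕ-fromℕ< d<m) ∘ sym)
    i≡ : toℕ i ≡ toℕ i ∸ d + toℕ first
    i≡ = trans (sym (ℕₚ.m∸n+n≡m d≤i)) (cong (toℕ i ∸ d +_) (sym (Finₚ.toℕ-fromℕ< d<m)))

m∸[1+[m∸[1+n]]]≡n : ∀ {m n} → n ℕ.< m → m ∸ suc (m ∸ suc n) ≡ n
m∸[1+[m∸[1+n]]]≡n {suc m} (s≤s n≤m) = ℕₚ.m∸[m∸n]≡n n≤m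

toℕ-punchIn-below : ∀ {n} (p : Fin (suc n)) j → toℕ j ℕ.< toℕ p → toℕ (punchIn p j) ≡ toℕ j
toℕ-punchIn-below (Fin.suc p) Fin.zero    _         = refl
toℕ-punchIn-below (Fin.suc p) (Fin.suc j) (s≤s j<p) = cong suc (toℕ-punchIn-below p j j<p)

toℕ-punchIn-unshifted : ∀ {n} (p : Fin (suc n)) j → toℕ (punchIn p j) ℕ.< toℕ p → toℕ (punchIn p j) ≡ toℕ j
toℕ-punchIn-unshifted (Fin.suc p) Fin.zero    _         = refl
toℕ-punchIn-unshifted (Fin.suc p) (Fin.suc j) (s≤s j<p) = cong suc (toℕ-punchIn-unshifted p j j<p)

toℕ-punchIn-shifted : ∀ {n} (p : Fin (suc n)) j → toℕ p ℕ.< toℕ (punchIn p j) → toℕ (punchIn p j) ≡ suc (toℕ j)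
toℕ-punchIn-shifted Fin.zero    j           _         = refl
toℕ-punchIn-shifted (Fin.suc p) (Fin.suc j) (s≤s p<j) = cong suc (toℕ-punchIn-shifted p j p<j)

toℕ-punchIn-cancel : ∀ {n n′} (p : Fin (suc n)) (p′ : Fin (suc n′)) a b → toℕ p ≡ toℕ p′ →
                     toℕ (punchIn p a) ≡ toℕ (punchIn p′ b) → toℕ a ≡ toℕ b
toℕ-punchIn-cancel Fin.zero    Fin.zero     a           b           _  eq = ℕₚ.suc-injective eq
toℕ-punchIn-cancel (Fin.suc p) (Fin.suc p′) Fin.zero    Fin.zero    _  _  = refl
toℕ-punchIn-cancel (Fin.suc p) (Fin.suc p′) (Fin.suc a) (Fin.suc b) p≡ eq =
  cong suc (toℕ-punchIn-cancel p p′ a b (ℕₚ.suc-injective p≡) (ℕₚ.suc-injective eq))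

punchIn-mono-< : ∀ {n} (p : Fin (suc n)) {j k} → j Fin.< k → punchIn p j Fin.< punchIn p k
punchIn-mono-< p {j} {k} j<k = Finₚ.≤∧≢⇒< (Finₚ.punchIn-mono-≤ p j k (ℕₚ.<⇒≤ j<k))
                                           (ℕₚ.<⇒≢ j<k ∘ cong toℕ ∘ Finₚ.punchIn-injective p j k)

punchIn-cancel-< : ∀ {n} (p : Fin (suc n)) {j k} → punchIn p j Fin.< punchIn p k → j Fin.< k
punchIn-cancel-< p {j} {k} j<k = Finₚ.≤∧≢⇒< (Finₚ.punchIn-cancel-≤ p j k (ℕₚ.<⇒≤ j<k))
                                             (ℕₚ.<⇒≢ j<k ∘ cong (toℕ ∘ punchIn p))

IsMatching : ∀ {n m} → (Fin m → Fin n) → (Fin n → Fin n) → Set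
IsMatching c σ = IsFPFInvolution σ × OpeningSetIs σ c

isMatching? : ∀ {n m} (c : Fin m → Fin n) → Decidable (IsMatching c)
isMatching? c σ = isFPFInvolution? σ ×-dec openingSetIs? σ c

IsMatching-resp-≗ : ∀ {n m} (c : Fin m → Fin n) {f g} → f ≗ g → IsMatching c f → IsMatching c g
IsMatching-resp-≗ c {f} {g} f≗g (invol , opens) =
  (λ i → trans (sym (trans (cong f (f≗g i)) (f≗g (g i)))) (proj₁ (invol i)) , proj₂ (invol i) ∘ trans (f≗g i)) ,
  (λ i → proj₁ (opens i) ∘ subst (i Fin.<_) (sym (f≗g i)) , subst (i Fin.<_) (f≗g i) ∘ proj₂ (opens i))

v-resp-≗ : ∀ {n} {f g : Fin n → Fin n} → f ≗ g → v f ≡ v g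
v-resp-≗ {n} {f} {g} f≗g = count-cong (crossing? f) (crossing? g) (λ _ → mk⇔ (to f≗g) (to (sym ∘ f≗g)))
                                      (cartesianProduct (allFin n) (allFin n))
  where
  to : ∀ {f g} {i k} → f ≗ g → Crossing f (i , k) → Crossing g (i , k)
  to {i = i} {k} f≗g (i<k , k<fi , fi<fk) =
    i<k , subst (k Fin.<_) (f≗g i) k<fi , subst₂ Fin._<_ (f≗g i) (f≗g k) fi<fk

multiplicity-matchings : ∀ {n m} (c : Fin m → Fin n) g → count (_≗? g) (matchings n c) ≡ 𝟙 (isMatching? c g)
multiplicity-matchings {n} c g with isMatching? c g
... | yes gm = begin
  count (_≗? g) (matchings n c)                               ≡⟨ count-filter (_≗? g) (isMatching? c) (allFuns n n) ⟩
  count (λ f → (f ≗? g) ×-dec isMatching? c f) (allFuns n n)  ≡⟨ count-cong _ (_≗? g) equiv (allFuns n n) ⟩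
  count (_≗? g) (allFuns n n)                                 ≡⟨ count-allFuns n n g ⟩
  1                                                           ∎
  where
  open ≡-Reasoning
  equiv : ∀ f → (f ≗ g × IsMatching c f) ⇔ f ≗ g
  equiv f = mk⇔ proj₁ (λ f≗g → f≗g , IsMatching-resp-≗ c (sym ∘ f≗g) gm)
... | no ¬gm = trans (count-filter (_≗? g) (isMatching? c) (allFuns n n))
                     (count-none _ (λ f (f≗g , fm) → ¬gm (IsMatching-resp-≗ c f≗g fm)) (allFuns n n))

-- Removing the first closing arc

module ArcSurgery {n m} {c : Fin (suc m) → Fin (suc (suc n))} (c↑ : StrictlyIncreasing c)
                  (prefix : FixedPrefix c) (d≤1+n : FixedPrefix.d prefix ℕ.≤ suc n) where

  open FixedPrefix prefix

  Node : Set
  Node = Fin (suc (suc n))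

  node-d : Node
  node-d = fromℕ< (s≤s d≤1+n)

  toℕ-node-d : toℕ node-d ≡ d
  toℕ-node-d = Finₚ.toℕ-fromℕ< (s≤s d≤1+n)

  opening-below-d : ∀ p → toℕ p ℕ.< d → ∃ λ i → c i ≡ p
  opening-below-d p p<d = i , Finₚ.toℕ-injective (trans (fixed i (subst (ℕ._< d) (sym toℕ-i) p<d)) toℕ-i)
    where
    i = fromℕ< (ℕₚ.<-≤-trans p<d d≤m)
    toℕ-i = Finₚ.toℕ-fromℕ< (ℕₚ.<-≤-trans p<d d≤m)

  closing-d : ∀ i → c i ≢ node-d
  closing-d i ci≡d with toℕ i ℕ.<? d | trans (cong toℕ ci≡d) toℕ-node-d
  ... | yes i<d | ci≡d′ = ℕₚ.<-irrefl (trans (sym (fixed i i<d)) ci≡d′) i<d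
  ... | no  i≮d | ci≡d′ = ℕₚ.<-irrefl (sym ci≡d′) (ℕₚ.≤-<-trans (ℕₚ.≮⇒≥ i≮d) (moved i (ℕₚ.≮⇒≥ i≮d)))

  module _ {g : Node → Node} (g-matching : IsMatching c g) where

    opens-below-d : ∀ p → toℕ p ℕ.< d → p Fin.< g p
    opens-below-d p p<d = proj₂ (proj₂ g-matching p) (opening-below-d p p<d)

    partner-beyond-d : ∀ p → toℕ p ℕ.< d → d ℕ.≤ toℕ (g p)
    partner-beyond-d p p<d = ℕₚ.≮⇒≥ λ gp<d → ℕₚ.<-asym (opens-below-d p p<d)
      (subst (g p Fin.<_) (proj₁ (proj₁ g-matching p)) (opens-below-d (g p) gp<d))

    partner-of-d : toℕ (g node-d) ℕ.< d
    partner-of-d with ℕₚ.<-cmp (toℕ (g node-d)) d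
    ... | tri< gd<d _ _ = gd<d
    ... | tri≈ _ gd≡d _ =
      ⊥-elim (proj₂ (proj₁ g-matching node-d) (Finₚ.toℕ-injective (trans gd≡d (sym toℕ-node-d))))
    ... | tri> _ _ d<gd =
      ⊥-elim (closing-d _ (proj₂ (proj₁ (proj₂ g-matching node-d)
                                         (subst (ℕ._< toℕ (g node-d)) (sym toℕ-node-d) d<gd))))

  -- The arc (o, d) is indexed by the number t = d − 1 − o of arcs crossing it.
  module Arc (t : Fin d) where

    o : ℕ
    o = d ∸ suc (toℕ t)

    o<d : o ℕ.< d
    o<d = ℕₚ.∸-monoʳ-< {d} {suc (toℕ t)} {0} (s≤s z≤n) (Finₚ.toℕ<n t)

    -- o⁻ is node o among the nodes other than d, so that skip lists the remaining nodes in order.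
    o⁻ : Fin (suc n)
    o⁻ = fromℕ< (ℕₚ.<-≤-trans o<d d≤1+n)

    toℕ-o⁻ : toℕ o⁻ ≡ o
    toℕ-o⁻ = Finₚ.toℕ-fromℕ< (ℕₚ.<-≤-trans o<d d≤1+n)

    node-o : Node
    node-o = punchIn node-d o⁻

    toℕ-node-o : toℕ node-o ≡ o
    toℕ-node-o = trans (toℕ-punchIn-below node-d o⁻ (subst₂ ℕ._<_ (sym toℕ-o⁻) (sym toℕ-node-d) o<d)) toℕ-o⁻

    o<node-d : node-o Fin.< node-d
    o<node-d = subst₂ ℕ._<_ (sym toℕ-node-o) (sym toℕ-node-d) o<d

    index-o : Fin (suc m)
    index-o = fromℕ< (ℕₚ.<-≤-trans o<d d≤m)

    toℕ-index-o : toℕ index-o ≡ o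
    toℕ-index-o = Finₚ.toℕ-fromℕ< (ℕₚ.<-≤-trans o<d d≤m)

    c-index-o : c index-o ≡ node-o
    c-index-o = Finₚ.toℕ-injective
      (trans (fixed index-o (subst (ℕ._< d) (sym toℕ-index-o) o<d)) (trans toℕ-index-o (sym toℕ-node-o)))

    skip : Fin n → Node
    skip x = punchIn node-d (punchIn o⁻ x)

    skip≢d : ∀ x → skip x ≢ node-d
    skip≢d x = Finₚ.punchInᵢ≢i node-d (punchIn o⁻ x)

    skip≢o : ∀ x → skip x ≢ node-o
    skip≢o x = Finₚ.punchInᵢ≢i o⁻ x ∘ Finₚ.punchIn-injective node-d _ _

    skip-injective : ∀ {x y} → skip x ≡ skip y → x ≡ y
    skip-injective = Finₚ.punchIn-injective o⁻ _ _ ∘ Finₚ.punchIn-injective node-d _ _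

    skip-mono-< : ∀ {x y} → x Fin.< y → skip x Fin.< skip y
    skip-mono-< = punchIn-mono-< node-d ∘ punchIn-mono-< o⁻

    skip-cancel-< : ∀ {x y} → skip x Fin.< skip y → x Fin.< y
    skip-cancel-< = punchIn-cancel-< o⁻ ∘ punchIn-cancel-< node-d

    unskip : ∀ z → node-d ≢ z → node-o ≢ z → Fin n
    unskip z d≢z o≢z = punchOut {i = o⁻} {j = punchOut d≢z}
                                (λ e → o≢z (trans (cong (punchIn node-d) e) (Finₚ.punchIn-punchOut d≢z)))

    skip-unskip : ∀ z d≢z o≢z → skip (unskip z d≢z o≢z) ≡ z
    skip-unskip z d≢z o≢z =
      trans (cong (punchIn node-d) (Finₚ.punchIn-punchOut _)) (Finₚ.punchIn-punchOut d≢z)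

    data NodeView : Node → Set where
      at-d    : NodeView node-d
      at-o    : NodeView node-o
      skipped : ∀ x → NodeView (skip x)

    view : ∀ z → NodeView z
    view z with node-d Finₚ.≟ z | node-o Finₚ.≟ z
    ... | yes refl | _        = at-d
    ... | no _     | yes refl = at-o
    ... | no d≢z   | no o≢z   = subst NodeView (skip-unskip z d≢z o≢z) (skipped (unskip z d≢z o≢z))

    addArc : (Fin n → Fin n) → Node → Node
    addArc σ z with node-d Finₚ.≟ z
    ... | yes _ = node-o
    ... | no d≢z with o⁻ Finₚ.≟ punchOut d≢z
    ...   | yes _ = node-d
    ...   | no o≢ = skip (σ (punchOut o≢))

    module _ (σ : Fin n → Fin n) where

      addArc-d : addArc σ node-d ≡ node-o
      addArc-d with node-d Finₚ.≟ node-d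
      ... | yes _  = refl
      ... | no d≢d = ⊥-elim (d≢d refl)

      addArc-o : addArc σ node-o ≡ node-d
      addArc-o with node-d Finₚ.≟ node-o
      ... | yes d≡o = ⊥-elim (ℕₚ.<-irrefl (cong toℕ (sym d≡o)) o<node-d)
      ... | no d≢o with o⁻ Finₚ.≟ punchOut d≢o
      ...   | yes _ = refl
      ...   | no o≢ = ⊥-elim (o≢ (sym (Finₚ.punchIn-injective node-d _ _ (Finₚ.punchIn-punchOut d≢o))))

      addArc-skip : ∀ x → addArc σ (skip x) ≡ skip (σ x)
      addArc-skip x with node-d Finₚ.≟ skip x
      ... | yes d≡ = ⊥-elim (skip≢d x (sym d≡))
      ... | no d≢ with o⁻ Finₚ.≟ punchOut d≢ | Finₚ.punchIn-injective node-d _ _ (Finₚ.punchIn-punchOut d≢)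
      ...   | yes o≡ | x≡ = ⊥-elim (Finₚ.punchInᵢ≢i o⁻ x (sym (trans o≡ x≡)))
      ...   | no o≢  | x≡ =
        cong (skip ∘ σ) (Finₚ.punchIn-injective o⁻ _ _ (trans (Finₚ.punchIn-punchOut o≢) x≡))

    o≢c-punchIn : ∀ y → node-o ≢ c (punchIn index-o y)
    o≢c-punchIn y = Finₚ.punchInᵢ≢i index-o y ∘ sym ∘ increasing-injective c↑ ∘ trans c-index-o

    c⁻ : Fin m → Fin n
    c⁻ y = unskip (c (punchIn index-o y)) (closing-d _ ∘ sym) (o≢c-punchIn y)

    skip-c⁻ : ∀ y → skip (c⁻ y) ≡ c (punchIn index-o y)
    skip-c⁻ y = skip-unskip _ (closing-d _ ∘ sym) (o≢c-punchIn y)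

    c⁻↑ : StrictlyIncreasing c⁻
    c⁻↑ y y′ y<y′ = skip-cancel-<
      (subst₂ Fin._<_ (sym (skip-c⁻ y)) (sym (skip-c⁻ y′)) (c↑ _ _ (punchIn-mono-< index-o y<y′)))

    c⁻-image : ∀ x → (∃ λ y → c⁻ y ≡ x) ⇔ (∃ λ i → c i ≡ skip x)
    c⁻-image x = mk⇔ (λ (y , c⁻y≡x) → punchIn index-o y , trans (sym (skip-c⁻ y)) (cong skip c⁻y≡x)) from
      where
      from : (∃ λ i → c i ≡ skip x) → ∃ λ y → c⁻ y ≡ x
      from (i , ci≡x) with index-o Finₚ.≟ i
      ... | yes refl = ⊥-elim (skip≢o x (trans (sym ci≡x) c-index-o))
      ... | no o≢i   = punchOut o≢i
                     , skip-injective (trans (skip-c⁻ _) (trans (cong c (Finₚ.punchIn-punchOut o≢i)) ci≡x))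

    addArc-matching : ∀ σ → IsMatching c⁻ σ → IsMatching c (addArc σ)
    addArc-matching σ (invol , opens) = invol′ , opens′
      where
      invol′ : IsFPFInvolution (addArc σ)
      invol′ z with view z
      ... | at-d = trans (cong (addArc σ) (addArc-d σ)) (addArc-o σ)
                 , λ e → ℕₚ.<-irrefl (cong toℕ (trans (sym (addArc-d σ)) e)) o<node-d
      ... | at-o = trans (cong (addArc σ) (addArc-o σ)) (addArc-d σ)
                 , λ e → ℕₚ.<-irrefl (cong toℕ (trans (sym e) (addArc-o σ))) o<node-d
      ... | skipped x =
        trans (cong (addArc σ) (addArc-skip σ x)) (trans (addArc-skip σ (σ x)) (cong skip (proj₁ (invol x))))
        , λ e → proj₂ (invol x) (skip-injective (trans (sym (addArc-skip σ x)) e))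
      opens′ : OpeningSetIs (addArc σ) c
      opens′ z with view z
      ... | at-d = (λ d<o → ⊥-elim (ℕₚ.<-asym o<node-d (subst (node-d Fin.<_) (addArc-d σ) d<o)))
                 , λ (i , ci≡d) → ⊥-elim (closing-d i ci≡d)
      ... | at-o = (λ _ → index-o , c-index-o) , λ _ → subst (node-o Fin.<_) (sym (addArc-o σ)) o<node-d
      ... | skipped x =
        (λ x<σx → Equivalence.to (c⁻-image x)
                    (proj₁ (opens x) (skip-cancel-< (subst (skip x Fin.<_) (addArc-skip σ x) x<σx))))
        , λ x-opens → subst (skip x Fin.<_) (sym (addArc-skip σ x))
                            (skip-mono-< (proj₂ (opens x) (Equivalence.from (c⁻-image x) x-opens)))

    -- The fallback value x is never used when g pairs node-d with node-o.
    removeArc : (Node → Node) → Fin n → Fin n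
    removeArc g x with node-d Finₚ.≟ g (skip x) | node-o Finₚ.≟ g (skip x)
    ... | no d≢ | no o≢ = unskip (g (skip x)) d≢ o≢
    ... | _     | _     = x

    module _ {g : Node → Node} (g-matching : IsMatching c g) (g-d : g node-d ≡ node-o) where

      private
        g-invol : ∀ z → g (g z) ≡ z
        g-invol z = proj₁ (proj₁ g-matching z)

      g-o : g node-o ≡ node-d
      g-o = trans (cong g (sym g-d)) (g-invol node-d)

      skip-removeArc : ∀ x → skip (removeArc g x) ≡ g (skip x)
      skip-removeArc x with node-d Finₚ.≟ g (skip x) | node-o Finₚ.≟ g (skip x)
      ... | no d≢  | no o≢  = skip-unskip _ d≢ o≢
      ... | yes d≡ | _      = ⊥-elim (skip≢o x (trans (sym (g-invol (skip x))) (trans (cong g (sym d≡)) g-d)))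
      ... | no _   | yes o≡ = ⊥-elim (skip≢d x (trans (sym (g-invol (skip x))) (trans (cong g (sym o≡)) g-o)))

      removeArc-matching : IsMatching c⁻ (removeArc g)
      removeArc-matching = invol , opens
        where
        invol : IsFPFInvolution (removeArc g)
        invol x = skip-injective (trans (skip-removeArc (removeArc g x))
                                        (trans (cong g (skip-removeArc x)) (g-invol (skip x))))
                , λ e → proj₂ (proj₁ g-matching (skip x)) (trans (sym (skip-removeArc x)) (cong skip e))
        opens : OpeningSetIs (removeArc g) c⁻
        opens x = (λ x<gx → Equivalence.from (c⁻-image x) (proj₁ (proj₂ g-matching (skip x))
                               (subst (skip x Fin.<_) (skip-removeArc x) (skip-mono-< x<gx))))
                , λ x-opens → skip-cancel-< (subst (skip x Fin.<_) (sym (skip-removeArc x))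
                               (proj₂ (proj₂ g-matching (skip x)) (Equivalence.to (c⁻-image x) x-opens)))

      addArc-≗ : ∀ σ → addArc σ ≗ g ⇔ σ ≗ removeArc g
      addArc-≗ σ = mk⇔ to from
        where
        to : addArc σ ≗ g → σ ≗ removeArc g
        to e x = skip-injective (trans (sym (addArc-skip σ x)) (trans (e (skip x)) (sym (skip-removeArc x))))
        from : σ ≗ removeArc g → addArc σ ≗ g
        from e z with view z
        ... | at-d      = trans (addArc-d σ) (sym g-d)
        ... | at-o      = trans (addArc-o σ) (sym g-o)
        ... | skipped x = trans (addArc-skip σ x) (trans (cong skip (e x)) (skip-removeArc x))

    ∑-split : (f : Node → ℕ) → sum f ≡ f node-d + (f node-o + ∑[ x < n ] f (skip x))
    ∑-split f = trans (sum-remove {i = node-d} f) (cong (f node-d +_) (sum-remove {i = o⁻} (f ∘ punchIn node-d)))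

    module _ (σ : Fin n → Fin n) (σ-matching : IsMatching c⁻ σ) where

      private
        g = addArc σ
        g-matching = addArc-matching σ σ-matching
        g-invol : ∀ z → g (g z) ≡ z
        g-invol z = proj₁ (proj₁ g-matching z)

      no-crossing-from-d : ∀ k → ¬ Crossing g (node-d , k)
      no-crossing-from-d k (d<k , k<gd , _) =
        ℕₚ.<-asym o<node-d (ℕₚ.<-trans d<k (subst (k Fin.<_) (addArc-d σ) k<gd))

      crossing-from-o : ∀ k → Crossing g (node-o , k) ⇔ (o ℕ.< toℕ k × toℕ k ℕ.< d)
      crossing-from-o k = mk⇔
        (λ (o<k , k<go , _) → subst (ℕ._< toℕ k) toℕ-node-o o<k
                            , subst (toℕ k ℕ.<_) (trans (cong toℕ (addArc-o σ)) toℕ-node-d) k<go)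
        (λ (o<k , k<d) → let o<k′ = subst (ℕ._< toℕ k) (sym toℕ-node-o) o<k in
           o<k′ , subst (k Fin.<_) (sym (addArc-o σ)) (subst (toℕ k ℕ.<_) (sym toℕ-node-d) k<d)
                , subst (Fin._< g k) (sym (addArc-o σ)) (d<gk k<d (λ gk≡d → ℕₚ.<-irrefl (cong toℕ (o≡k gk≡d)) o<k′)))
        where
        d<gk : toℕ k ℕ.< d → g k ≢ node-d → node-d Fin.< g k
        d<gk k<d gk≢d = Finₚ.≤∧≢⇒< (subst (ℕ._≤ toℕ (g k)) (sym toℕ-node-d) (partner-beyond-d g-matching k k<d))
                                   (gk≢d ∘ sym)
        o≡k : g k ≡ node-d → node-o ≡ k
        o≡k gk≡d = trans (sym (addArc-d σ)) (trans (cong g (sym gk≡d)) (g-invol k))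

      no-crossing-into-d : ∀ x → ¬ Crossing g (skip x , node-d)
      no-crossing-into-d x (_ , d<gx , gx<gd) =
        ℕₚ.<-asym o<node-d (ℕₚ.<-trans d<gx (subst (g (skip x) Fin.<_) (addArc-d σ) gx<gd))

      no-crossing-into-o : ∀ x → ¬ Crossing g (skip x , node-o)
      no-crossing-into-o x (x<o , _ , gx<go) = ℕₚ.<⇒≱ (ℕₚ.<-trans x<o o<node-d) (begin
        toℕ node-d            ≡⟨ toℕ-node-d ⟩
        d                     ≤⟨ partner-beyond-d g-matching (g (skip x)) gx<d ⟩
        toℕ (g (g (skip x)))  ≡⟨ cong toℕ (g-invol (skip x)) ⟩
        toℕ (skip x)          ∎)
        where
        open ℕₚ.≤-Reasoning
        gx<d = subst (toℕ (g (skip x)) ℕ.<_) toℕ-node-d (subst (g (skip x) Fin.<_) (addArc-o σ) gx<go)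

      crossing-skip : ∀ x y → Crossing g (skip x , skip y) ⇔ Crossing σ (x , y)
      crossing-skip x y = mk⇔
        (λ (x<y , y<gx , gx<gy) → skip-cancel-< x<y
                                , skip-cancel-< (subst (skip y Fin.<_) (addArc-skip σ x) y<gx)
                                , skip-cancel-< (subst₂ Fin._<_ (addArc-skip σ x) (addArc-skip σ y) gx<gy))
        (λ (x<y , y<σx , σx<σy) → skip-mono-< x<y
                                , subst (skip y Fin.<_) (sym (addArc-skip σ x)) (skip-mono-< y<σx)
                                , subst₂ Fin._<_ (sym (addArc-skip σ x)) (sym (addArc-skip σ y)) (skip-mono-< σx<σy))

      v-addArc : v g ≡ toℕ t + v σ
      v-addArc = begin
        v g                                                     ≡⟨ count-cartesianProduct (crossing? g) ⟩
        sum row                                                 ≡⟨ ∑-split row ⟩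
        row node-d + (row node-o + ∑[ x < n ] row (skip x))
          ≡⟨ cong₂ _+_ row-d (cong₂ _+_ row-o (sum-cong-≗ {n} row-skip)) ⟩
        toℕ t + ∑[ x < n ] ∑[ y < n ] 𝟙 (crossing? σ (x , y))
          ≡⟨ cong (toℕ t +_) (count-cartesianProduct (crossing? σ)) ⟨
        toℕ t + v σ                                             ∎
        where
        open ≡-Reasoning
        row : Node → ℕ
        row i = ∑[ k < suc (suc n) ] 𝟙 (crossing? g (i , k))
        row-d : row node-d ≡ 0
        row-d = trans (sum-cong-≗ {suc (suc n)} (λ k → 𝟙-no (crossing? g (node-d , k)) (no-crossing-from-d k)))
                      (sum-replicate-zero (suc (suc n)))
        row-o : row node-o ≡ toℕ t
        row-o = begin
          row node-o                                                      ≡⟨ sum-cong-≗ {suc (suc n)} (λ k →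
            𝟙-cong (crossing? g (node-o , k)) ((o ℕ.<? toℕ k) ×-dec (toℕ k ℕ.<? d)) (crossing-from-o k)) ⟩
          ∑[ k < suc (suc n) ] 𝟙 ((o ℕ.<? toℕ k) ×-dec (toℕ k ℕ.<? d))
            ≡⟨ ∑-between _ o d (ℕₚ.m≤n⇒m≤1+n d≤1+n) ⟩
          d ∸ suc o                                                       ≡⟨ m∸[1+[m∸[1+n]]]≡n (Finₚ.toℕ<n t) ⟩
          toℕ t                                                           ∎
        row-skip : ∀ x → row (skip x) ≡ ∑[ y < n ] 𝟙 (crossing? σ (x , y))
        row-skip x = trans (∑-split (λ k → 𝟙 (crossing? g (skip x , k)))) (cong₂ _+_
          (𝟙-no (crossing? g _) (no-crossing-into-d x))
          (cong₂ _+_ (𝟙-no (crossing? g _) (no-crossing-into-o x))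
                     (sum-cong-≗ {n} (λ y → 𝟙-cong (crossing? g _) (crossing? σ (x , y)) (crossing-skip x y)))))

    -- Below d both conditions hold; from d on, the index moves by one and the value by two.
    rank-condition : ∀ (j : Fin m) y →
      (toℕ (c (punchIn index-o y)) ℕ.≤ suc (toℕ j) + toℕ (punchIn index-o y)) ⇔ (toℕ (c⁻ y) ℕ.≤ toℕ j + toℕ y)
    rank-condition j y with toℕ (punchIn index-o y) ℕ.<? d
    ... | yes i<d = mk⇔ (λ _ → ℕₚ.≤-trans (ℕₚ.≤-reflexive c⁻y≡y) (ℕₚ.m≤n+m _ _))
                        (λ _ → ℕₚ.≤-trans (ℕₚ.≤-reflexive ci≡i) (ℕₚ.m≤n+m _ _))
      where
      ci≡i = fixed (punchIn index-o y) i<d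
      skip≡i : toℕ (skip (c⁻ y)) ≡ toℕ (punchIn index-o y)
      skip≡i = trans (cong toℕ (skip-c⁻ y)) ci≡i
      c⁻y≡y : toℕ (c⁻ y) ≡ toℕ y
      c⁻y≡y = toℕ-punchIn-cancel o⁻ index-o (c⁻ y) y (trans toℕ-o⁻ (sym toℕ-index-o))
        (trans (sym (toℕ-punchIn-unshifted node-d _ (subst₂ ℕ._<_ (sym skip≡i) (sym toℕ-node-d) i<d))) skip≡i)
    ... | no i≮d = mk⇔ (λ le → ℕ.s≤s⁻¹ (ℕ.s≤s⁻¹ (subst₂ ℕ._≤_ ci≡ rhs≡ le)))
                       (λ le → subst₂ ℕ._≤_ (sym ci≡) (sym rhs≡) (s≤s (s≤s le)))
      where
      d≤i = ℕₚ.≮⇒≥ i≮d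
      i≡ : toℕ (punchIn index-o y) ≡ suc (toℕ y)
      i≡ = toℕ-punchIn-shifted index-o y
             (subst (ℕ._< toℕ (punchIn index-o y)) (sym toℕ-index-o) (ℕₚ.<-≤-trans o<d d≤i))
      d<skip : toℕ node-d ℕ.< toℕ (skip (c⁻ y))
      d<skip = subst₂ ℕ._<_ (sym toℕ-node-d) (sym (cong toℕ (skip-c⁻ y))) (ℕₚ.≤-<-trans d≤i (moved _ d≤i))
      skip≡ : toℕ (skip (c⁻ y)) ≡ suc (toℕ (punchIn o⁻ (c⁻ y)))
      skip≡ = toℕ-punchIn-shifted node-d _ d<skip
      o<p : toℕ o⁻ ℕ.< toℕ (punchIn o⁻ (c⁻ y))
      o<p = subst (ℕ._< toℕ (punchIn o⁻ (c⁻ y))) (sym toℕ-o⁻)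
                  (ℕₚ.<-≤-trans o<d (ℕ.s≤s⁻¹ (subst₂ ℕ._<_ toℕ-node-d skip≡ d<skip)))
      ci≡ : toℕ (c (punchIn index-o y)) ≡ suc (suc (toℕ (c⁻ y)))
      ci≡ = trans (cong toℕ (sym (skip-c⁻ y))) (trans skip≡ (cong suc (toℕ-punchIn-shifted o⁻ _ o<p)))
      rhs≡ : suc (toℕ j) + toℕ (punchIn index-o y) ≡ suc (suc (toℕ j + toℕ y))
      rhs≡ = cong suc (trans (cong (toℕ j +_) i≡) (ℕₚ.+-suc (toℕ j) (toℕ y)))

    r-suc : ∀ j → r c (Fin.suc j) ≡ suc (r c⁻ j)
    r-suc j = begin
      r c (Fin.suc j)                                         ≡⟨ count-tabulate P? id ⟩
      ∑[ i < suc m ] 𝟙 (P? i)                                 ≡⟨ sum-remove {i = index-o} (𝟙 ∘ P?) ⟩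
      𝟙 (P? index-o) + ∑[ y < m ] 𝟙 (P? (punchIn index-o y))  ≡⟨ cong₂ _+_ (𝟙-yes (P? index-o) o-counted)
        (sum-cong-≗ {m} (λ y → 𝟙-cong (P? _) (Q? y) (rank-condition j y))) ⟩
      suc (∑[ y < m ] 𝟙 (Q? y))                               ≡⟨ cong suc (count-tabulate Q? id) ⟨
      suc (r c⁻ j)                                            ∎
      where
      open ≡-Reasoning
      P? = λ i → toℕ (c i) ℕ.≤? toℕ (Fin.suc j) + toℕ i
      Q? = λ y → toℕ (c⁻ y) ℕ.≤? toℕ j + toℕ y
      o-counted : toℕ (c index-o) ℕ.≤ suc (toℕ j) + toℕ index-o
      o-counted = ℕₚ.≤-trans (ℕₚ.≤-reflexive (fixed index-o (subst (ℕ._< d) (sym toℕ-index-o) o<d)))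
                             (ℕₚ.m≤n+m _ _)

  r-zero : r c Fin.zero ≡ d
  r-zero = begin
    r c Fin.zero                             ≡⟨ count-tabulate (λ i → toℕ (c i) ℕ.≤? toℕ i) id ⟩
    ∑[ i < suc m ] 𝟙 (toℕ (c i) ℕ.≤? toℕ i)  ≡⟨ sum-cong-≗ {suc m} (λ i →
      𝟙-cong (toℕ (c i) ℕ.≤? toℕ i) (toℕ i ℕ.<? d) (mk⇔ (to i) (ℕₚ.≤-reflexive ∘ fixed i))) ⟩
    ∑[ i < suc m ] 𝟙 (toℕ i ℕ.<? d)          ≡⟨ ∑-below (suc m) d d≤m ⟩
    d                                        ∎
    where
    open ≡-Reasoning
    to : ∀ i → toℕ (c i) ℕ.≤ toℕ i → toℕ i ℕ.< d
    to i ci≤i = ℕₚ.≰⇒> λ d≤i → ℕₚ.<⇒≱ (moved i d≤i) ci≤i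

  module _ {g : Node → Node} (g-matching : IsMatching c g) where

    first-arc : Fin d
    first-arc = fromℕ< (ℕₚ.∸-monoʳ-< {d} {suc (toℕ (g node-d))} {0} (s≤s z≤n) (partner-of-d g-matching))

    node-o-first-arc : Arc.node-o first-arc ≡ g node-d
    node-o-first-arc = Finₚ.toℕ-injective (begin
      toℕ (Arc.node-o first-arc)          ≡⟨ Arc.toℕ-node-o first-arc ⟩
      d ∸ suc (toℕ first-arc)             ≡⟨ cong (λ k → d ∸ suc k) (Finₚ.toℕ-fromℕ< _) ⟩
      d ∸ suc (d ∸ suc (toℕ (g node-d)))  ≡⟨ m∸[1+[m∸[1+n]]]≡n (partner-of-d g-matching) ⟩
      toℕ (g node-d)                      ∎)
      where open ≡-Reasoning

    first-arc-unique : ∀ t → Arc.node-o t ≡ g node-d → t ≡ first-arc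
    first-arc-unique t o≡gd = Finₚ.toℕ-injective (begin
      toℕ t                      ≡⟨ m∸[1+[m∸[1+n]]]≡n (Finₚ.toℕ<n t) ⟨
      d ∸ suc (d ∸ suc (toℕ t))  ≡⟨ cong (λ k → d ∸ suc k) (trans (sym (Arc.toℕ-node-o t)) (cong toℕ o≡gd)) ⟩
      d ∸ suc (toℕ (g node-d))   ≡⟨ Finₚ.toℕ-fromℕ< _ ⟨
      toℕ first-arc              ∎)
      where open ≡-Reasoning

  family : Fin d → List (Node → Node)
  family t = map (Arc.addArc t) (matchings n (Arc.c⁻ t))

  multiplicity-family : ∀ t g →
    count (_≗? g) (family t) ≡ 𝟙 (isMatching? c g ×-dec (g node-d Finₚ.≟ Arc.node-o t))
  multiplicity-family t g = begin
    count (_≗? g) (family t)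
      ≡⟨ count-map (_≗? g) addArc (matchings n c⁻) ⟩
    count (λ σ → addArc σ ≗? g) (matchings n c⁻)
      ≡⟨ count-filter (λ σ → addArc σ ≗? g) (isMatching? c⁻) (allFuns n n) ⟩
    count (λ σ → (addArc σ ≗? g) ×-dec isMatching? c⁻ σ) (allFuns n n)
      ≡⟨ by-first-arc (isMatching? c g ×-dec (g node-d Finₚ.≟ node-o)) ⟩
    𝟙 (isMatching? c g ×-dec (g node-d Finₚ.≟ node-o))
      ∎
    where
    open ≡-Reasoning
    open Arc t
    by-first-arc : (h? : Dec (IsMatching c g × g node-d ≡ node-o)) →
                   count (λ σ → (addArc σ ≗? g) ×-dec isMatching? c⁻ σ) (allFuns n n) ≡ 𝟙 h?
    by-first-arc (yes (gm , gd≡o)) =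
      trans (count-cong _ (_≗? removeArc g) equiv (allFuns n n)) (count-allFuns n n (removeArc g))
      where
      equiv : ∀ σ → (addArc σ ≗ g × IsMatching c⁻ σ) ⇔ σ ≗ removeArc g
      equiv σ = mk⇔ (Equivalence.to (addArc-≗ gm gd≡o σ) ∘ proj₁)
                    (λ σ≗ → Equivalence.from (addArc-≗ gm gd≡o σ) σ≗
                          , IsMatching-resp-≗ c⁻ (sym ∘ σ≗) (removeArc-matching gm gd≡o))
    by-first-arc (no ¬h) = count-none _ (λ σ (addArc≗g , σm) →
      ¬h (IsMatching-resp-≗ c addArc≗g (addArc-matching σ σm) , trans (sym (addArc≗g node-d)) (addArc-d σ)))
      (allFuns n n)

  multiplicity-families : ∀ g → count (_≗? g) (concatMap family (allFin d)) ≡ 𝟙 (isMatching? c g)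
  multiplicity-families g = trans (count-concatMap (_≗? g) family)
    (trans (sum-cong-≗ {d} (λ t → multiplicity-family t g)) (total (isMatching? c g)))
    where
    first-arc-at : ∀ t → Dec (IsMatching c g × g node-d ≡ Arc.node-o t)
    first-arc-at t = isMatching? c g ×-dec (g node-d Finₚ.≟ Arc.node-o t)
    total : (gm? : Dec (IsMatching c g)) → ∑[ t < d ] 𝟙 (first-arc-at t) ≡ 𝟙 gm?
    total (yes gm) = trans
      (∑-single-support _ (first-arc gm) λ t t≢ →
        𝟙-no (first-arc-at t) (t≢ ∘ first-arc-unique gm t ∘ sym ∘ proj₂))
      (𝟙-yes (first-arc-at _) (gm , sym (node-o-first-arc gm)))
    total (no ¬gm) = trans (sum-cong-≗ {d} (λ t → 𝟙-no (first-arc-at t) (¬gm ∘ proj₁))) (sum-replicate-zero d)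

module _ {a ℓ : Level} (R : CommutativeSemiring a ℓ) (q : CommutativeSemiring.Carrier R) where

  private module R = CommutativeSemiring R
  open R using (Carrier; _≈_; _*_; *-congˡ; semiring; setoid; +-commutativeMonoid)
  open import Algebra.Properties.Semiring.Exp semiring using (_^_; ^-homo-*)
  open import Relation.Binary.Reasoning.Setoid setoid

  private
    Σ : List Carrier → Carrier
    Σ = Σ-list R

  Σ-++ : ∀ xs ys → Σ (xs ++ ys) ≈ Σ xs R.+ Σ ys
  Σ-++ []       ys = R.sym (R.+-identityˡ _)
  Σ-++ (x ∷ xs) ys = R.trans (R.+-congˡ (Σ-++ xs ys)) (R.sym (R.+-assoc _ _ _))

  Σ-map-concatMap : ∀ {n} (w : A → Carrier) (F : Fin n → List A) →
                    Σ (map w (concatMap F (allFin n))) ≈ Σ (tabulate (λ i → Σ (map w (F i))))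
  Σ-map-concatMap w F = go id
    where
    go : ∀ {k} (f : Fin k → _) → Σ (map w (concatMap F (tabulate f))) ≈ Σ (tabulate (λ i → Σ (map w (F (f i)))))
    go {zero}  f = R.refl
    go {suc k} f = begin
      Σ (map w (F (f Fin.zero) ++ rest))          ≡⟨ cong Σ (Listₚ.map-++ w (F (f Fin.zero)) rest) ⟩
      Σ (map w (F (f Fin.zero)) ++ map w rest)    ≈⟨ Σ-++ (map w (F (f Fin.zero))) (map w rest) ⟩
      Σ (map w (F (f Fin.zero))) R.+ Σ (map w rest) ≈⟨ R.+-congˡ (go (f ∘ Fin.suc)) ⟩
      Σ (tabulate (λ i → Σ (map w (F (f i)))))    ∎
      where rest = concatMap F (tabulate (f ∘ Fin.suc))

  Σ-map-cong : {f g : A → Carrier} {xs : List A} → All (λ x → f x ≈ g x) xs → Σ (map f xs) ≈ Σ (map g xs)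
  Σ-map-cong []            = R.refl
  Σ-map-cong (fx≈gx ∷ all) = R.+-cong fx≈gx (Σ-map-cong all)

  Σ-tabulate-cong : ∀ {n} {f g : Fin n → Carrier} → (∀ i → f i ≈ g i) → Σ (tabulate f) ≈ Σ (tabulate g)
  Σ-tabulate-cong {zero}  f≈g = R.refl
  Σ-tabulate-cong {suc n} f≈g = R.+-cong (f≈g Fin.zero) (Σ-tabulate-cong (f≈g ∘ Fin.suc))

  *-distribˡ-Σ : ∀ k (f : A → Carrier) xs → Σ (map (λ x → k * f x) xs) ≈ k * Σ (map f xs)
  *-distribˡ-Σ k f []       = R.sym (R.zeroʳ k)
  *-distribˡ-Σ k f (x ∷ xs) = R.trans (R.+-congˡ (*-distribˡ-Σ k f xs)) (R.sym (R.distribˡ k _ _))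

  *-distribʳ-Σ : ∀ {n} (f : Fin n → Carrier) k → Σ (tabulate (λ i → f i * k)) ≈ Σ (tabulate f) * k
  *-distribʳ-Σ {zero}  f k = R.sym (R.zeroˡ k)
  *-distribʳ-Σ {suc n} f k = R.trans (R.+-congˡ (*-distribʳ-Σ (f ∘ Fin.suc) k)) (R.sym (R.distribʳ k _ _))

  weight : ∀ {n} → (Fin n → Fin n) → Carrier
  weight σ = q ^ v σ

  matchingSum : ∀ n {m} → (Fin m → Fin n) → Carrier
  matchingSum n c = Σ (map weight (matchings n c))

  module _ {n m} {c : Fin (suc m) → Fin (suc (suc n))} (c↑ : StrictlyIncreasing c)
           (prefix : FixedPrefix c) (d≤1+n : FixedPrefix.d prefix ℕ.≤ suc n) where

    open FixedPrefix prefix using (d)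
    open ArcSurgery c↑ prefix d≤1+n

    matchingSum-by-first-arc :
      matchingSum (suc (suc n)) c ≈ Σ (tabulate (λ t → q ^ toℕ t * matchingSum n (Arc.c⁻ t)))
    matchingSum-by-first-arc = begin
      matchingSum (suc (suc n)) c                     ≈⟨ Multiplicity.foldr-map-resp-multiplicity
        (≗-decSetoid _ _) +-commutativeMonoid (R.reflexive ∘ cong (q ^_) ∘ v-resp-≗) (matchings _ c)
        (concatMap family (allFin d)) (λ g → trans (multiplicity-matchings c g) (sym (multiplicity-families g))) ⟩
      Σ (map weight (concatMap family (allFin d)))    ≈⟨ Σ-map-concatMap weight family ⟩
      Σ (tabulate (λ t → Σ (map weight (family t))))  ≈⟨ Σ-tabulate-cong family-sum ⟩
      Σ (tabulate (λ t → q ^ toℕ t * matchingSum n (Arc.c⁻ t))) ∎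
      where
      family-sum : ∀ t → Σ (map weight (family t)) ≈ q ^ toℕ t * matchingSum n (Arc.c⁻ t)
      family-sum t = begin
        Σ (map weight (map addArc M))           ≡⟨ cong Σ (sym (Listₚ.map-∘ M)) ⟩
        Σ (map (weight ∘ addArc) M)             ≈⟨ Σ-map-cong (All.map weight-addArc (all-filter (isMatching? c⁻) (allFuns n n))) ⟩
        Σ (map (λ σ → q ^ toℕ t * weight σ) M)  ≈⟨ *-distribˡ-Σ (q ^ toℕ t) weight M ⟩
        q ^ toℕ t * matchingSum n c⁻            ∎
        where
        open Arc t
        M = matchings n c⁻
        weight-addArc : ∀ {σ} → IsMatching c⁻ σ → weight (addArc σ) ≈ q ^ toℕ t * weight σ
        weight-addArc {σ} σm = R.trans (R.reflexive (cong (q ^_) (v-addArc σ σm))) (^-homo-* q (toℕ t) (v σ))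

  rankProduct : ∀ {n} m → (Fin m → Fin n) → Carrier
  rankProduct m c = Π-list R (tabulate (λ j → qInt R q (r c j ∸ toℕ j)))

  matchingSum≈rankProduct : ∀ n m (c : Fin m → Fin n) → n ≡ m + m → StrictlyIncreasing c →
                            matchingSum n c ≈ rankProduct m c
  matchingSum≈rankProduct zero          zero    c _  _ = R.+-identityʳ _
  matchingSum≈rankProduct (suc zero)    (suc m) c 1≡ _ with () ← trans (ℕₚ.suc-injective 1≡) (ℕₚ.+-suc m m)
  matchingSum≈rankProduct (suc (suc n)) (suc m) c n≡ c↑ = begin
    matchingSum (suc (suc n)) c                                ≈⟨ matchingSum-by-first-arc c↑ prefix d≤1+n ⟩
    Σ (tabulate (λ t → q ^ toℕ t * matchingSum n (Arc.c⁻ t)))  ≈⟨ Σ-tabulate-cong (λ t → *-congˡ (induction t)) ⟩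
    Σ (tabulate {n = d} (λ t → q ^ toℕ t * rest))              ≈⟨ *-distribʳ-Σ {d} (λ t → q ^ toℕ t) rest ⟩
    qInt R q d * rest                                          ≡⟨ cong (λ k → qInt R q k * rest) r-zero ⟨
    rankProduct (suc m) c                                      ∎
    where
    n≡m+m : n ≡ m + m
    n≡m+m = ℕₚ.suc-injective (trans (ℕₚ.suc-injective n≡) (ℕₚ.+-suc m m))
    prefix = fixedPrefix c↑
    open FixedPrefix prefix using (d; d≤m)
    d≤1+n : d ℕ.≤ suc n
    d≤1+n = ℕₚ.≤-trans d≤m (s≤s (subst (m ℕ.≤_) (sym n≡m+m) (ℕₚ.m≤m+n m m)))
    open ArcSurgery c↑ prefix d≤1+n
    rest : Carrier
    rest = Π-list R (tabulate {n = m} (λ j → qInt R q (r c (Fin.suc j) ∸ toℕ (Fin.suc j))))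
    induction : ∀ t → matchingSum n (Arc.c⁻ t) ≈ rest
    induction t = R.trans (matchingSum≈rankProduct n m (Arc.c⁻ t) n≡m+m (Arc.c⁻↑ t))
      (R.reflexive (cong (Π-list R) (Listₚ.tabulate-cong λ j →
        cong (λ k → qInt R q (k ∸ suc (toℕ j))) (sym (Arc.r-suc t j)))))

open import Data.Nat using (_*_)

lemma5p2 : ∀ {a ℓ : Level} (R : CommutativeSemiring a ℓ) (q : CommutativeSemiring.Carrier R)
             (m : ℕ) (c : Fin m → Fin (2 * m)) → StrictlyIncreasing c →
             CommutativeSemiring._≈_ R (crossingGF R q m c) (productFormula R q m c)
lemma5p2 R q m c c↑ = matchingSum≈rankProduct R q (2 * m) m c (cong (m +_) (ℕₚ.+-identityʳ m)) c↑
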